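{- For every positive integer $N$ there exists a word $w$ of length $N$ over the binary alphabet $\{0,1\}$ such that $p_w(n)=n+1$ for $1\le n\le \lfloor N/2\rfloor$ and $p_w(n)=N-n+1$ for $\lceil N/2\rceil\le n\le N$.
   Context: A subword (factor) of a word $w=w_1\cdots w_N$ is a contiguous block $w_iw_{i+1}\cdots w_j$; $p_w(n)$ is the number of distinct subwords of $w$ of length $n$. -}

module Defs where

open import Data.Bool using (Bool)
open import Data.Bool.Properties using () renaming (_≟_ to _≟B_)
open import Data.Nat using (ℕ; _∸_; suc)
open import Data.List using (List; length; take; drop; map; upTo; deduplicate)
open import Data.List.Properties using (≡-dec)

-- Binary words over the alphabet {0,1}, encoded as Bool (false = 0, true = 1).
Word : Set
Word = List Bool

-- The list of all (occurrences of) subwords of length n of w: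
-- w_{i+1} ... w_{i+n} for 0 ≤ i ≤ |w| - n  (only meaningful for n ≤ |w|).
factorsOfLength : ℕ → Word → List Word
factorsOfLength n w = map (λ i → take n (drop i w)) (upTo (suc (length w ∸ n)))

complexity : Word → ℕ → ℕ
complexity w n = length (deduplicate (≡-dec _≟B_) (factorsOfLength n w))

module Submission where

-- The witness for a word of length N = a + 1 + b is the "spike word"
--   0^a 1 0^b,   with a = ⌈(N-1)/2⌉ and b = ⌊(N-1)/2⌋, so that a ≤ b + 1.
-- Every length-n factor of it is a "spike" of length n: a word with a
-- single 1 at some position j < n, or (j ≥ n) the all-zero word 0^n.
-- Spikes of length n with j ≤ n are pairwise distinct, so:
--   * short factors (n ≤ a): every one of the n + 1 spikes occurs, and
--     nothing else does, hence p(n) = n + 1;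
--   * long factors (b + 1 ≤ n): the factor starting at i has its 1 at
--     position a - i ≤ n, so all N - n + 1 factor occurrences are distinct,
--     hence p(n) = N - n + 1.
-- The file first proves a general counting principle for `deduplicate`,
-- then the facts about spikes, then locates the factors of the spike word,
-- derives the two complexity formulas, and finally instantiates a and b.

open import Defs
open import Data.Nat using (ℕ; zero; suc; _+_; _∸_; _≤_; _<_; z≤n; s≤s; ⌊_/2⌋; ⌈_/2⌉)
open import Data.Nat.Properties
open import Data.Bool using (true; false)
open import Data.Bool.Properties using () renaming (_≟_ to _≟B_)
open import Data.List using (List; []; _∷_; length; take; drop; map; upTo; replicate; deduplicate; _++_)
open import Data.List.Properties using (≡-dec; length-map; length-upTo; length-replicate; ∷-injectiveʳ)
open import Data.Product using (Σ; _×_; _,_)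
open import Relation.Nullary using (yes; no)
open import Relation.Binary.Definitions using (DecidableEquality)
open import Relation.Binary.PropositionalEquality using (_≡_; _≢_; refl; sym; trans; cong; subst; module ≡-Reasoning)
open import Function using (id)
open import Function.Bundles using (mk⇔; module Equivalence)
open import Data.List.Membership.Propositional using (_∈_)
open import Data.List.Membership.Propositional.Properties using (deduplicate-∈⇔; ∈-map⁺; ∈-map⁻; ∈-upTo⁺; ∈-upTo⁻)
open import Data.List.Membership.Propositional.Properties.WithK using (unique∧set⇒bag)
open import Data.List.Relation.Unary.Unique.Propositional using (Unique)
open import Data.List.Relation.Binary.BagAndSetEquality using (∼bag⇒↭)
open import Data.List.Relation.Binary.Permutation.Propositional.Properties using (↭-length)
import Data.List.Relation.Unary.Unique.DecPropositional.Properties as UniqueDec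
import Data.List.Relation.Unary.AllPairs.Properties as AllPairs

length-deduplicate : {A : Set} (_≟_ : DecidableEquality A) {xs ys : List A} →
  Unique ys → (∀ {z} → z ∈ xs → z ∈ ys) → (∀ {z} → z ∈ ys → z ∈ xs) →
  length (deduplicate _≟_ xs) ≡ length ys
length-deduplicate _≟_ {xs} unique-ys xs⊆ys ys⊆xs =
  ↭-length (∼bag⇒↭ (unique∧set⇒bag (UniqueDec.deduplicate-! _≟_ xs) unique-ys
    (mk⇔ (λ z∈dd → xs⊆ys (from z∈dd)) (λ z∈ys → to (ys⊆xs z∈ys)))))
  where
  from : ∀ {z} → z ∈ deduplicate _≟_ xs → z ∈ xs
  from = Equivalence.from (deduplicate-∈⇔ _≟_)
  to : ∀ {z} → z ∈ xs → z ∈ deduplicate _≟_ xs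
  to = Equivalence.to (deduplicate-∈⇔ _≟_)

unique-map-upTo : {A : Set} (f : ℕ → A) (m : ℕ) →
  (∀ {i j} → i < j → j < m → f i ≢ f j) → Unique (map f (upTo m))
unique-map-upTo f m injective = AllPairs.map⁺ (AllPairs.applyUpTo⁺₁ id m injective)

factor : ℕ → Word → ℕ → Word
factor n u i = take n (drop i u)

length-factorsOfLength : ∀ n u → length (factorsOfLength n u) ≡ length u ∸ n + 1
length-factorsOfLength n u = begin
  length (map (factor n u) (upTo (suc (length u ∸ n))))
    ≡⟨ length-map (factor n u) (upTo (suc (length u ∸ n))) ⟩
  length (upTo (suc (length u ∸ n)))
    ≡⟨ length-upTo (suc (length u ∸ n)) ⟩
  suc (length u ∸ n)
    ≡⟨ +-comm 1 (length u ∸ n) ⟩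
  length u ∸ n + 1 ∎
  where open ≡-Reasoning

position⇒fits : ∀ {i n L} → n ≤ L → i < suc (L ∸ n) → i + n ≤ L
position⇒fits {i} n≤L (s≤s i≤L∸n) = m≤o∸n⇒m+n≤o i n≤L i≤L∸n

fits⇒position : ∀ {i n L} → i + n ≤ L → i < suc (L ∸ n)
fits⇒position {i} i+n≤L = s≤s (m+n≤o⇒m≤o∸n i i+n≤L)

factor-replicate : {A : Set} (x : A) → ∀ m k n → k + n ≤ m →
  take n (drop k (replicate m x)) ≡ replicate n x
factor-replicate x m       zero    zero    _         = refl
factor-replicate x (suc m) zero    (suc n) (s≤s n≤m) = cong (x ∷_) (factor-replicate x m zero n n≤m)
factor-replicate x (suc m) (suc k) n       (s≤s fits) = factor-replicate x m k n fits

zeros : ℕ → Word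
zeros n = replicate n false

spike : ℕ → ℕ → Word
spike zero    j       = []
spike (suc n) zero    = true ∷ zeros n
spike (suc n) (suc j) = false ∷ spike n j

spike-beyond : ∀ n j → n ≤ j → spike n j ≡ zeros n
spike-beyond zero    j       _         = refl
spike-beyond (suc n) (suc j) (s≤s n≤j) = cong (false ∷_) (spike-beyond n j n≤j)

spike-injective : ∀ n j k → j ≤ n → k ≤ n → spike n j ≡ spike n k → j ≡ k
spike-injective zero    zero    zero    _         _         _  = refl
spike-injective (suc n) zero    zero    _         _         _  = refl
spike-injective (suc n) (suc j) (suc k) (s≤s j≤n) (s≤s k≤n) eq =
  cong suc (spike-injective n j k j≤n k≤n (∷-injectiveʳ eq))
spike-injective (suc n) zero    (suc k) _         _         ()
spike-injective (suc n) (suc j) zero    _         _         ()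

spikes : ℕ → List Word
spikes n = map (spike n) (upTo (suc n))

length-spikes : ∀ n → length (spikes n) ≡ n + 1
length-spikes n = trans (length-map (spike n) (upTo (suc n)))
                        (trans (length-upTo (suc n)) (+-comm 1 n))

unique-spikes : ∀ n → Unique (spikes n)
unique-spikes n = unique-map-upTo (spike n) (suc n) λ {i} {j} i<j j<n+1 eq →
  let j≤n = ≤-pred j<n+1
  in <-irrefl (spike-injective n i j (≤-trans (<⇒≤ i<j) j≤n) j≤n eq) i<j

spike∈spikes : ∀ n j → spike n j ∈ spikes n
spike∈spikes n j with j ≤? n
... | yes j≤n = ∈-map⁺ (spike n) (∈-upTo⁺ (s≤s j≤n))
... | no  j≰n = subst (_∈ spikes n)
                      (trans (spike-beyond n n ≤-refl) (sym (spike-beyond n j (<⇒≤ (≰⇒> j≰n)))))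
                      (∈-map⁺ (spike n) (∈-upTo⁺ (s≤s ≤-refl)))

spikeWord : ℕ → ℕ → Word
spikeWord a b = zeros a ++ true ∷ zeros b

length-spikeWord : ∀ a b → length (spikeWord a b) ≡ a + suc b
length-spikeWord zero    b = cong suc (length-replicate b)
length-spikeWord (suc a) b = cong suc (length-spikeWord a b)

factor-before-one : ∀ a b i n → i ≤ a → i + n ≤ a + suc b →
  factor n (spikeWord a b) i ≡ spike n (a ∸ i)
factor-before-one a       b zero    zero    _         _          = refl
factor-before-one zero    b zero    (suc n) _         (s≤s n≤b)  = cong (true ∷_) (factor-replicate false b 0 n n≤b)
factor-before-one (suc a) b zero    (suc n) _         (s≤s fits) = cong (false ∷_) (factor-before-one a b 0 n z≤n fits)
factor-before-one (suc a) b (suc i) n       (s≤s i≤a) (s≤s fits) = factor-before-one a b i n i≤a fits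

factor-after-one : ∀ a b i n → a < i → i + n ≤ a + suc b →
  factor n (spikeWord a b) i ≡ zeros n
factor-after-one zero    b (suc i) n _         (s≤s fits) = factor-replicate false b i n fits
factor-after-one (suc a) b (suc i) n (s≤s a<i) (s≤s fits) = factor-after-one a b i n a<i fits

-- Short factors: for n ≤ a ≤ b + 1 the factors of length n are exactly the spikes.
complexity-short : ∀ a b n → a ≤ suc b → n ≤ a → complexity (spikeWord a b) n ≡ n + 1
complexity-short a b n a≤b+1 n≤a =
  trans (length-deduplicate (≡-dec _≟B_) (unique-spikes n) factor∈spikes spike∈factors)
        (length-spikes n)
  where
  fits : ∀ {i} → i < suc (length (spikeWord a b) ∸ n) → i + n ≤ a + suc b
  fits i<m = subst (_ ≤_) (length-spikeWord a b)
    (position⇒fits (subst (n ≤_) (sym (length-spikeWord a b)) (≤-trans n≤a (m≤m+n a (suc b)))) i<m)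

  factor∈spikes : ∀ {z} → z ∈ factorsOfLength n (spikeWord a b) → z ∈ spikes n
  factor∈spikes z∈ with ∈-map⁻ (factor n (spikeWord a b)) z∈
  ... | i , i∈ , refl with i ≤? a
  ...   | yes i≤a = subst (_∈ spikes n) (sym (factor-before-one a b i n i≤a (fits (∈-upTo⁻ i∈))))
                          (spike∈spikes n (a ∸ i))
  ...   | no  i≰a = subst (_∈ spikes n)
                          (trans (spike-beyond n n ≤-refl) (sym (factor-after-one a b i n (≰⇒> i≰a) (fits (∈-upTo⁻ i∈)))))
                          (spike∈spikes n n)

  -- The spike with its 1 at position j ≤ n occurs at position a - j.
  spike∈factors : ∀ {z} → z ∈ spikes n → z ∈ factorsOfLength n (spikeWord a b)
  spike∈factors z∈ with ∈-map⁻ (spike n) z∈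
  ... | j , j∈ , refl = subst (_∈ factorsOfLength n (spikeWord a b)) occurrence
                              (∈-map⁺ (factor n (spikeWord a b)) (∈-upTo⁺ (fits⇒position {a ∸ j} {n} position-fits)))
    where
    j≤a : j ≤ a
    j≤a = ≤-trans (≤-pred (∈-upTo⁻ j∈)) n≤a
    fits-in-word : (a ∸ j) + n ≤ a + suc b
    fits-in-word = +-mono-≤ (m∸n≤m a j) (≤-trans n≤a a≤b+1)
    position-fits : (a ∸ j) + n ≤ length (spikeWord a b)
    position-fits = subst (_ ≤_) (sym (length-spikeWord a b)) fits-in-word
    occurrence : factor n (spikeWord a b) (a ∸ j) ≡ spike n j
    occurrence = trans (factor-before-one a b (a ∸ j) n (m∸n≤m a j) fits-in-word)
                       (cong (spike n) (m∸[m∸n]≡n j≤a))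

-- Long factors: for b + 1 ≤ n, each occurrence starts at some i ≤ a and is
-- the spike with its 1 at position a - i ≤ n, so all occurrences differ.
complexity-long : ∀ a b n → a ≤ suc b → suc b ≤ n → n ≤ length (spikeWord a b) →
  complexity (spikeWord a b) n ≡ length (spikeWord a b) ∸ n + 1
complexity-long a b n a≤b+1 b<n n≤L =
  trans (length-deduplicate (≡-dec _≟B_) unique-factors id id)
        (length-factorsOfLength n (spikeWord a b))
  where
  fits : ∀ {i} → i < suc (length (spikeWord a b) ∸ n) → i + n ≤ a + suc b
  fits i<m = subst (_ ≤_) (length-spikeWord a b) (position⇒fits n≤L i<m)

  starts-before-one : ∀ {i} → i + n ≤ a + suc b → i ≤ a
  starts-before-one {i} i+n≤ = +-cancelʳ-≤ (suc b) i a (≤-trans (+-monoʳ-≤ i b<n) i+n≤)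

  occurrence : ∀ {i} → i + n ≤ a + suc b → factor n (spikeWord a b) i ≡ spike n (a ∸ i)
  occurrence i+n≤ = factor-before-one a b _ n (starts-before-one i+n≤) i+n≤

  one-within : ∀ i → a ∸ i ≤ n
  one-within i = ≤-trans (m∸n≤m a i) (≤-trans a≤b+1 b<n)

  unique-factors : Unique (factorsOfLength n (spikeWord a b))
  unique-factors = unique-map-upTo (factor n (spikeWord a b)) _ λ {i} {j} i<j j<m eq →
    let j-fits = fits j<m
        i-fits = ≤-trans (+-monoˡ-≤ n (<⇒≤ i<j)) j-fits
        same-one = spike-injective n (a ∸ i) (a ∸ j) (one-within i) (one-within j)
                     (trans (sym (occurrence i-fits)) (trans eq (occurrence j-fits)))
    in <-irrefl (sym same-one) (∸-monoʳ-< i<j (starts-before-one j-fits))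

-- For N = M + 1 take a = ⌈M/2⌉ and b = ⌊M/2⌋; then ⌊N/2⌋ = a and
-- ⌈N/2⌉ = b + 1 hold by computation, and a ≤ b + 1.
proposition6p3 : (N : ℕ) → 1 ≤ N →
    Σ Word (λ w → length w ≡ N
    × ((n : ℕ) → 1 ≤ n → n ≤ ⌊ N /2⌋ → complexity w n ≡ n + 1)
    × ((n : ℕ) → ⌈ N /2⌉ ≤ n → n ≤ N → complexity w n ≡ N ∸ n + 1))
proposition6p3 (suc M) _ =
    spikeWord a b
  , length≡N
  , (λ n _ n≤a → complexity-short a b n a≤b+1 n≤a)
  , (λ n b<n n≤N → subst (λ L → complexity (spikeWord a b) n ≡ L ∸ n + 1) length≡N
                     (complexity-long a b n a≤b+1 b<n (subst (n ≤_) (sym length≡N) n≤N)))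
  where
  a = ⌈ M /2⌉
  b = ⌊ M /2⌋

  a≤b+1 : a ≤ suc b
  a≤b+1 = ⌊n/2⌋≤⌈n/2⌉ (suc M)

  length≡N : length (spikeWord a b) ≡ suc M
  length≡N = trans (length-spikeWord a b)
    (trans (+-suc a b) (cong suc (trans (+-comm a b) (⌊n/2⌋+⌈n/2⌉≡n M))))
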